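{- Let $\varphi$ and $\psi$ be LTL formulas, let $w$ be a word of length $J$ over $2^{\mathrm{AP}}$, and let $x=v_\varphi(w)$ and $y=v_\psi(w)$ be their truth words on $w$. Then the automaton $\mathcal A_{\mathcal U}$ (defined below), run on the word $(x,y)=((x_j,y_j))_{j\in J}$ over $\{0,1\}^2$, outputs the truth word $v_{\varphi{\mathcal U}\psi}(w)$; i.e. $\mathcal A_{\mathcal U}$ has an accepting run on $(x,y)$ and the output of its accepting run is $v_{\varphi{\mathcal U}\psi}(w)$.
   Context: Linear orderings, cuts, words: a cut of a linear ordering $J$ is a partition $(K,L)$ of $J$ with $k<l$ for all $k\in K,l\in L$; the set $\hat J$ of cuts is ordered by inclusion of left parts, extended to $J\cup\hat J$ by $(K,L)<j$ iff $j\in L$; $c_{\min}=(\emptyset,J)$, $c_{\max}=(J,\emptyset)$, $c_j^-=(\{i<j\},\{i\ge j\})$, $c_j^+=(\{i\le j\},\{i>j\})$. A word of length $J$ is a family indexed by $J$. LTL semantics: $w,i\models\varphi{\mathcal U}\psi$ iff there is a position $j>i$ with $w,j\models\psi$ and $w,k\models\varphi$ for all $i<k<j$ (strict until); $v_\chi(w)$ is the word of length $J$ over $\{0,1\}$ with $1$ exactly at positions where $\chi$ holds. (Formulas may use $\neg,\vee,{\mathcal U},{\mathcal S},{\mathcal U}',{\mathcal S}'$; only the semantics of ${\mathcal U}$ matters here beyond $\varphi,\psi$ having truth words.) Automata: $(Q,\Sigma,\Gamma,\delta,I,F)$ with $\delta\subseteq(Q\times\Sigma\times\Gamma\times Q)\cup(2^Q\times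 Q)\cup(Q\times 2^Q)$ (successor transitions $p\xrightarrow{a|b}q$, left limit transitions $P\to q$, right limit transitions $q\to P$). For $\rho$ a word over $Q$ indexed by $\hat J$: $\lim_{c^- }\rho=\{q\mid\forall d<c\ \exists e\,(d<e<c\wedge\rho_e=q)\}$, $\lim_{c^+}\rho=\{q\mid\forall d>c\ \exists e\,(c<e<d\wedge\rho_e=q)\}$. An accepting run on $(z_j)_{j\in J}$ is $\rho$ of length $\hat J$ over $Q$ with output letters $(o_j)_{j\in J}$ such that $\rho_{c_{\min}}\in I$, $\rho_{c_{\max}}\in F$, $(\rho_{c_j^- },z_j,o_j,\rho_{c_j^+})\in\delta$ for all $j$, $(\lim_{c^- }\rho,\rho_c)\in\delta$ for every $c\neq c_{\min}$ without predecessor, and $(\rho_c,\lim_{c^+}\rho)\in\delta$ for every $c\neq c_{\max}$ without successor; its output is $(o_j)_{j\in J}$. The automaton $\mathcal A_{\mathcal U}$: states $q_0,q_1,q_2,q_3,q_4$, input alphabet $\{0,1\}^2$, output alphabet $\{0,1\}$, all states initial, $q_4$ the only final state. Successor transitions: for every pair of states $(q,q')$ except $q=q_2,q'\in\{q_3,q_4\}$ and $q=q_4,q'\in\{q_0,q_1,q_2\}$, there is exactly one successor transition $q\xrightarrow{a|o}q'$, where the input letter $a$ is $(1,1)$ if $q=q_0$, $(0,1)$ if $q=q_1$, $(0,0)$ if $q=q_3$, $(1,0)$ if $q\in\{q_2,q_4\}$, and the output $o$ is $1$ if $q'\in\{q_0,q_1,q_2\}$ and $0$ if $q'\in\{q_3,q_4\}$.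 Left limit transitions: $P\to q$ for every state $q$ whenever $P$ contains $q_0$, $q_1$ or $q_3$; $\{q_2\}\to q_0$, $\{q_2\}\to q_1$, $\{q_2\}\to q_2$; $\{q_4\}\to q_3$, $\{q_4\}\to q_4$. Right limit transitions: $q_2\to\{q_0\}$, $q_2\to\{q_2\}$, $q_2\to\{q_0,q_2\}$; $q_4\to P$ whenever $P$ contains $q_1$ or $q_3$; $q_4\to\{q_4\}$. -}

module Defs where

open import Level using (Level; 0ℓ) renaming (suc to lsuc)
open import Data.Bool using (Bool; true; false)
open import Data.Product using (Σ; ∃; _×_; _,_)
open import Data.Sum using (_⊎_)
open import Data.Empty using (⊥-elim)
open import Data.Unit using (⊤)
open import Relation.Nullary using (¬_)
open import Relation.Binary.Core using (Rel)
open import Relation.Binary.Definitions using (Trichotomous; Irreflexive; Transitive; Tri; tri<; tri≈; tri>)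
open import Relation.Binary.PropositionalEquality using (_≡_; refl; subst; sym)
open import Function.Bundles using (_⇔_)

record LinearOrder : Set₁ where
  field
    Carrier : Set
    _<_     : Rel Carrier 0ℓ
    irrefl  : Irreflexive _≡_ _<_
    trans   : Transitive _<_
    compare : Trichotomous _≡_ _<_

-- Cuts of a linear ordering J.  A cut (K,L) is given by the
-- characteristic function of its left part K; L is the complement.

module _ (J : LinearOrder) where
  open LinearOrder J

  record Cut : Set where
    field
      left : Carrier → Bool
      sep  : ∀ k l → left k ≡ true → left l ≡ false → k < l
  open Cut public

  _≈ᶜ_ : Cut → Cut → Set
  c ≈ᶜ d = ∀ i → left c i ≡ left d i

  _<ᶜ_ : Cut → Cut → Set
  c <ᶜ d = (∀ i → left c i ≡ true → left d i ≡ true)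
         × ∃ λ i → left c i ≡ false × left d i ≡ true

  cmin : Cut
  cmin = record { left = λ _ → false ; sep = λ { k l () _ } }

  cmax : Cut
  cmax = record { left = λ _ → true ; sep = λ { k l _ () } }

  private
    ltB : Carrier → Carrier → Bool
    ltB i j with compare i j
    ... | tri< _ _ _ = true
    ... | tri≈ _ _ _ = false
    ... | tri> _ _ _ = false

    leB : Carrier → Carrier → Bool
    leB i j with compare i j
    ... | tri< _ _ _ = true
    ... | tri≈ _ _ _ = true
    ... | tri> _ _ _ = false

    lt-sound : ∀ i j → ltB i j ≡ true → i < j
    lt-sound i j e with compare i j
    lt-sound i j refl | tri< a _ _ = a

    lt-false : ∀ l j → ltB l j ≡ false → (l ≡ j) ⊎ (j < l)
    lt-false l j e with compare l j
    lt-false l j () | tri< _ _ _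
    lt-false l j e | tri≈ _ b _ = Data.Sum.inj₁ b
    lt-false l j e | tri> _ _ c = Data.Sum.inj₂ c

    le-sound : ∀ i j → leB i j ≡ true → (i < j) ⊎ (i ≡ j)
    le-sound i j e with compare i j
    ... | tri< a _ _ = Data.Sum.inj₁ a
    ... | tri≈ _ b _ = Data.Sum.inj₂ b
    le-sound i j () | tri> _ _ _

    le-false : ∀ l j → leB l j ≡ false → j < l
    le-false l j e with compare l j
    le-false l j () | tri< _ _ _
    le-false l j () | tri≈ _ _ _
    le-false l j e | tri> _ _ c = c

  cminus : Carrier → Cut
  cminus j = record { left = λ i → ltB i j ; sep = s }
    where
    s : ∀ k l → ltB k j ≡ true → ltB l j ≡ false → k < l
    s k l p q with lt-false l j q
    ... | Data.Sum.inj₁ l≡j = subst (k <_) (sym l≡j) (lt-sound k j p)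
    ... | Data.Sum.inj₂ j<l = trans (lt-sound k j p) j<l

  cplus : Carrier → Cut
  cplus j = record { left = λ i → leB i j ; sep = s }
    where
    s : ∀ k l → leB k j ≡ true → leB l j ≡ false → k < l
    s k l p q with le-sound k j p
    ... | Data.Sum.inj₁ k<j = trans k<j (le-false l j q)
    ... | Data.Sum.inj₂ k≡j = subst (_< l) (sym k≡j) (le-false l j q)

  HasPred : Cut → Set
  HasPred c = ∃ λ d → d <ᶜ c × ¬ (∃ λ e → d <ᶜ e × e <ᶜ c)

  HasSucc : Cut → Set
  HasSucc c = ∃ λ d → c <ᶜ d × ¬ (∃ λ e → c <ᶜ e × e <ᶜ d)

  limL : {Q : Set} → (Cut → Q) → Cut → Q → Set
  limL ρ c q = ∀ d → d <ᶜ c → ∃ λ e → d <ᶜ e × e <ᶜ c × ρ e ≡ q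

  limR : {Q : Set} → (Cut → Q) → Cut → Q → Set
  limR ρ c q = ∀ d → c <ᶜ d → ∃ λ e → c <ᶜ e × e <ᶜ d × ρ e ≡ q

  Until : (Carrier → Bool) → (Carrier → Bool) → Carrier → Set
  Until x y i = ∃ λ j → i < j × y j ≡ true
                × (∀ k → i < k → k < j → x k ≡ true)

-- Automata over linear orderings with output.
-- Subsets of Q are predicates Q → Set.

record Automaton : Set₁ where
  field
    Q Σ' Γ   : Set
    succT    : Q → Σ' → Γ → Q → Set          -- p --a|b--> q
    leftT    : (Q → Set) → Q → Set           -- P → q
    rightT   : Q → (Q → Set) → Set           -- q → P
    initial  : Q → Set
    final    : Q → Set

module _ (A : Automaton) (J : LinearOrder) where
  open Automaton A
  open LinearOrder J

  record AcceptingRun (z : Carrier → Σ') : Set where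
    field
      ρ     : Cut J → Q
      out   : Carrier → Γ
      -- ρ is a word indexed by the set of cuts (well defined on cuts)
      resp  : ∀ c d → _≈ᶜ_ J c d → ρ c ≡ ρ d
      init  : initial (ρ (cmin J))
      fin   : final (ρ (cmax J))
      succ  : ∀ j → succT (ρ (cminus J j)) (z j) (out j) (ρ (cplus J j))
      limLeft  : ∀ c → ¬ (_≈ᶜ_ J c (cmin J)) → ¬ HasPred J c
                 → leftT (limL J ρ c) (ρ c)
      limRight : ∀ c → ¬ (_≈ᶜ_ J c (cmax J)) → ¬ HasSucc J c
                 → rightT (ρ c) (limR J ρ c)
  open AcceptingRun public

data St : Set where
  q0 q1 q2 q3 q4 : St

data Forbidden : St → St → Set where
  f23 : Forbidden q2 q3
  f24 : Forbidden q2 q4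
  f40 : Forbidden q4 q0
  f41 : Forbidden q4 q1
  f42 : Forbidden q4 q2

inLetter : St → Bool × Bool
inLetter q0 = true , true
inLetter q1 = false , true
inLetter q2 = true , false
inLetter q3 = false , false
inLetter q4 = true , false

outLetter : St → Bool
outLetter q0 = true
outLetter q1 = true
outLetter q2 = true
outLetter q3 = false
outLetter q4 = false

succU : St → Bool × Bool → Bool → St → Set
succU q a o q' = ¬ Forbidden q q' × a ≡ inLetter q × o ≡ outLetter q'

_≐_ : (St → Set) → (St → Set) → Set
P ≐ R = ∀ t → P t ⇔ R t

leftU : (St → Set) → St → Set
leftU P q =
    (P q0 ⊎ P q1 ⊎ P q3)
  ⊎ (P ≐ (λ t → t ≡ q2) × (q ≡ q0 ⊎ q ≡ q1 ⊎ q ≡ q2))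
  ⊎ (P ≐ (λ t → t ≡ q4) × (q ≡ q3 ⊎ q ≡ q4))

rightU : St → (St → Set) → Set
rightU q P =
    (q ≡ q2 × (P ≐ (λ t → t ≡ q0) ⊎ P ≐ (λ t → t ≡ q2)
               ⊎ P ≐ (λ t → t ≡ q0 ⊎ t ≡ q2)))
  ⊎ (q ≡ q4 × (P q1 ⊎ P q3))
  ⊎ (q ≡ q4 × P ≐ (λ t → t ≡ q4))

AU : Automaton
AU = record
  { Q = St ; Σ' = Bool × Bool ; Γ = Bool
  ; succT = succU ; leftT = leftU ; rightT = rightU
  ; initial = λ _ → ⊤
  ; final = λ q → q ≡ q4 }

module Submission where

-- The run of A_U on (x,y) is a word ρ indexed by the cuts of J.  Writing
-- Good c for "φ U ψ holds from the cut c" (some l to the right of c has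
-- y l = 1 and x = 1 on every position of c's right part before l), the
-- proof rests on one invariant: in every accepting run the output of the
-- state at c is Good c.  Since the output at j is that of ρ (c_j^+), and
-- Good (c_j^+) is exactly the until at j, this gives the second half.
--
-- With these, the
-- invariant is proved for an arbitrary accepting run by two continuous
-- inductions, and an accepting run is built explicitly: at a cut c_m^- it
-- reads the letter of m, elsewhere it sits in q2 or q4 according to Good c.

open import Defs
open import Level using (0ℓ)
open import Data.Bool using (Bool; true; false)
open import Data.Product using (_×_; _,_; ∃; proj₁; proj₂)
open import Data.Sum using (_⊎_; inj₁; inj₂; [_,_]′)
open import Data.Empty using (⊥; ⊥-elim)
open import Data.Unit using (tt)
open import Relation.Nullary using (¬_; Dec; yes; no)
open import Relation.Nullary.Decidable using (does; dec-true; dec-false)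
open import Relation.Binary.PropositionalEquality using (_≡_; refl; sym; trans; cong; subst; subst₂; module ≡-Reasoning)
open import Relation.Binary.Definitions using (tri<; tri≈; tri>)
open import Function.Bundles using (_⇔_; mk⇔; Equivalence)
open import Axiom.ExcludedMiddle using (ExcludedMiddle)
open import Axiom.DoubleNegationElimination using (em⇒dne)

true≢false : true ≡ false → ⊥
true≢false ()

bool-cases : (b : Bool) → b ≡ true ⊎ b ≡ false
bool-cases true = inj₁ refl
bool-cases false = inj₂ refl

module Classical (em : ExcludedMiddle 0ℓ) where

  byContradiction : {P : Set} → ¬ ¬ P → P
  byContradiction = em⇒dne em

  ¬∀⇒∃¬ : {A : Set} {P : A → Set} → ¬ (∀ a → P a) → ∃ λ a → ¬ P a
  ¬∀⇒∃¬ h = byContradiction λ ne → h λ a → byContradiction λ npa → ne (a , npa)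

  decide : Set → Bool
  decide P = does (em {P})

  decide-true : {P : Set} → P → decide P ≡ true
  decide-true p = dec-true em p

  decide-false : {P : Set} → ¬ P → decide P ≡ false
  decide-false np = dec-false em np

  decide-sound : {P : Set} → decide P ≡ true → P
  decide-sound {P} d with em {P}
  ... | yes p = p
  decide-sound () | no _

  decide-refute : {P : Set} → decide P ≡ false → ¬ P
  decide-refute d p = true≢false (trans (sym (decide-true p)) d)

  decide-cong : {P Q : Set} → (P → Q) → (Q → P) → decide P ≡ decide Q
  decide-cong {P} {Q} pq qp with em {P}
  ... | yes p = sym (decide-true (pq p))
  ... | no np = sym (decide-false λ q → np (qp q))

module CutOrder (em : ExcludedMiddle 0ℓ) (J : LinearOrder) where
  open Classical em
  open LinearOrder J renaming (Carrier to Pos; trans to <-trans)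

  Ĵ : Set
  Ĵ = Cut J

  c⁻ c⁺ : Pos → Ĵ
  c⁻ = cminus J
  c⁺ = cplus J

  variable
    i j k l m : Pos
    a b c d e p s : Ĵ
    P : Ĵ → Set

  <-irr : ¬ i < i
  <-irr = irrefl refl

  <-asym : i < j → ¬ j < i
  <-asym i<j j<i = <-irr (<-trans i<j j<i)

  L R : Ĵ → Pos → Set
  L c i = left c i ≡ true
  R c i = left c i ≡ false

  L-or-R : ∀ c i → L c i ⊎ R c i
  L-or-R c i = bool-cases (left c i)

  L∧R-⊥ : ∀ c → L c i → R c i → ⊥
  L∧R-⊥ c li ri = true≢false (trans (sym li) ri)

  L-down : ∀ c → L c j → i < j → L c i
  L-down {i = i} c lj i<j with L-or-R c i
  ... | inj₁ li = li
  ... | inj₂ ri = ⊥-elim (<-asym i<j (sep c _ i lj ri))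

  R-up : ∀ c → R c i → i < j → R c j
  R-up {j = j} c ri i<j with L-or-R c j
  ... | inj₁ lj = ⊥-elim (L∧R-⊥ c (L-down c lj i<j) ri)
  ... | inj₂ rj = rj

  infix 4 _⊑_ _⊏_ _≋_

  record _⊑_ (c d : Ĵ) : Set where
    constructor ⊑-intro
    field ⊑-L : L c i → L d i
  open _⊑_ public

  record _⊏_ (c d : Ĵ) : Set where
    constructor ⊏-intro
    field
      ⊏⇒⊑   : c ⊑ d
      gap   : Pos
      gap-R : R c gap
      gap-L : L d gap
  open _⊏_ public

  record _≋_ (c d : Ĵ) : Set where
    constructor ≋-intro
    field
      ≋⇒⊑ : c ⊑ d
      ≋⇒⊒ : d ⊑ c
  open _≋_ public

  ⊑-R : c ⊑ d → R d i → R c i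
  ⊑-R {c = c} {d = d} {i = i} c⊑d rd with L-or-R c i
  ... | inj₁ lc = ⊥-elim (L∧R-⊥ d (⊑-L c⊑d lc) rd)
  ... | inj₂ rc = rc

  ⊑-refl : c ⊑ c
  ⊑-refl = ⊑-intro λ l → l

  ⊑-trans : c ⊑ d → d ⊑ e → c ⊑ e
  ⊑-trans p q = ⊑-intro λ l → ⊑-L q (⊑-L p l)

  ⊏-⊑-trans : c ⊏ d → d ⊑ e → c ⊏ e
  ⊏-⊑-trans (⊏-intro p g r l) q = ⊏-intro (⊑-trans p q) g r (⊑-L q l)

  ⊑-⊏-trans : c ⊑ d → d ⊏ e → c ⊏ e
  ⊑-⊏-trans p (⊏-intro q g r l) = ⊏-intro (⊑-trans p q) g (⊑-R p r) l

  ⊏-trans : c ⊏ d → d ⊏ e → c ⊏ e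
  ⊏-trans p q = ⊑-⊏-trans (⊏⇒⊑ p) q

  ⊏⇒⋣ : c ⊏ d → ¬ d ⊑ c
  ⊏⇒⋣ {c = c} (⊏-intro _ g r l) q = L∧R-⊥ c (⊑-L q l) r

  ≋-sym : c ≋ d → d ≋ c
  ≋-sym (≋-intro p q) = ≋-intro q p

  ⊑-total : ∀ c d → c ⊑ d ⊎ d ⊏ c
  ⊑-total c d with em {c ⊑ d}
  ... | yes c⊑d = inj₁ c⊑d
  ... | no c⋢d with ¬∀⇒∃¬ (λ f → c⋢d (⊑-intro λ {i} → f i))
  ...   | i , ¬inc with L-or-R c i | L-or-R d i
  ...     | inj₁ lc | inj₁ ld = ⊥-elim (¬inc λ _ → ld)
  ...     | inj₂ rc | _ = ⊥-elim (¬inc λ lc → ⊥-elim (L∧R-⊥ c lc rc))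
  ...     | inj₁ lc | inj₂ rd =
    inj₂ (⊏-intro (⊑-intro λ lk → L-down c lc (sep d _ i lk rd)) i rd lc)

  ≋⇒≈ᶜ : c ≋ d → _≈ᶜ_ J c d
  ≋⇒≈ᶜ {c = c} {d = d} (≋-intro p q) i with L-or-R c i | L-or-R d i
  ... | inj₁ lc | _ = trans lc (sym (⊑-L p lc))
  ... | inj₂ rc | inj₁ ld = ⊥-elim (L∧R-⊥ c (⊑-L q ld) rc)
  ... | inj₂ rc | inj₂ rd = trans rc (sym rd)

  ≈ᶜ⇒≋ : _≈ᶜ_ J c d → c ≋ d
  ≈ᶜ⇒≋ eq = ≋-intro (⊑-intro λ {i} lc → trans (sym (eq i)) lc) (⊑-intro λ {i} ld → trans (eq i) ld)

  ⊏⇒<ᶜ : c ⊏ d → _<ᶜ_ J c d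
  ⊏⇒<ᶜ (⊏-intro p g r l) = (λ _ → ⊑-L p) , g , r , l

  <ᶜ⇒⊏ : _<ᶜ_ J c d → c ⊏ d
  <ᶜ⇒⊏ (p , g , r , l) = ⊏-intro (⊑-intro (p _)) g r l

  ⊑cmax : c ⊑ cmax J
  ⊑cmax = ⊑-intro λ _ → refl

  ≉cmax⇒⊏cmax : ¬ _≈ᶜ_ J c (cmax J) → c ⊏ cmax J
  ≉cmax⇒⊏cmax {c = c} ne with ¬∀⇒∃¬ ne
  ... | i , ¬li with L-or-R c i
  ...   | inj₁ li = ⊥-elim (¬li li)
  ...   | inj₂ ri = ⊏-intro ⊑cmax i ri refl

  ≉cmin⇒cmin⊏ : ¬ _≈ᶜ_ J c (cmin J) → cmin J ⊏ c
  ≉cmin⇒cmin⊏ {c = c} ne with ¬∀⇒∃¬ ne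
  ... | i , ¬ri with L-or-R c i
  ...   | inj₁ li = ⊏-intro (⊑-intro λ ()) i refl li
  ...   | inj₂ ri = ⊥-elim (¬ri ri)

  ⊏⇒≉cmax : c ⊏ d → ¬ _≈ᶜ_ J c (cmax J)
  ⊏⇒≉cmax (⊏-intro _ g r _) eq = true≢false (trans (sym (eq g)) r)

  ⊏⇒≉cmin : c ⊏ d → ¬ _≈ᶜ_ J d (cmin J)
  ⊏⇒≉cmin (⊏-intro _ g _ l) eq = true≢false (trans (sym l) (eq g))

  L⁻⇒< : L (c⁻ j) i → i < j
  L⁻⇒< {j = j} {i = i} li with compare i j
  ... | tri< i<j _ _ = i<j

  <⇒L⁻ : i < j → L (c⁻ j) i
  <⇒L⁻ {i = i} {j = j} i<j with compare i j
  ... | tri< _ _ _ = refl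
  ... | tri≈ ¬i<j _ _ = ⊥-elim (¬i<j i<j)
  ... | tri> ¬i<j _ _ = ⊥-elim (¬i<j i<j)

  ≮⇒R⁻ : ¬ i < j → R (c⁻ j) i
  ≮⇒R⁻ {i = i} {j = j} ¬i<j with compare i j
  ... | tri< i<j _ _ = ⊥-elim (¬i<j i<j)
  ... | tri≈ _ _ _ = refl
  ... | tri> _ _ _ = refl

  R⁻⇒≮ : R (c⁻ j) i → ¬ i < j
  R⁻⇒≮ {j = j} ri i<j = L∧R-⊥ (c⁻ j) (<⇒L⁻ i<j) ri

  ≯⇒L⁺ : ¬ j < i → L (c⁺ j) i
  ≯⇒L⁺ {j = j} {i = i} ¬j<i with compare i j
  ... | tri< _ _ _ = refl
  ... | tri≈ _ _ _ = refl
  ... | tri> _ _ j<i = ⊥-elim (¬j<i j<i)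

  <⇒R⁺ : j < i → R (c⁺ j) i
  <⇒R⁺ {j = j} {i = i} j<i with compare i j
  ... | tri< i<j _ _ = ⊥-elim (<-asym i<j j<i)
  ... | tri≈ _ refl _ = ⊥-elim (<-irr j<i)
  ... | tri> _ _ _ = refl

  L⁺⇒≯ : L (c⁺ j) i → ¬ j < i
  L⁺⇒≯ {j = j} li j<i = L∧R-⊥ (c⁺ j) li (<⇒R⁺ j<i)

  R⁺⇒< : R (c⁺ j) i → j < i
  R⁺⇒< {j = j} {i = i} ri with compare i j
  ... | tri> _ _ j<i = j<i

  ≮∧≯⇒≡ : ¬ k < j → ¬ j < k → k ≡ j
  ≮∧≯⇒≡ {k = k} {j = j} ¬k<j ¬j<k with compare k j
  ... | tri< k<j _ _ = ⊥-elim (¬k<j k<j)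
  ... | tri≈ _ k≡j _ = k≡j
  ... | tri> _ _ j<k = ⊥-elim (¬j<k j<k)

  between-c⁻-c⁺ : R (c⁻ j) k → L (c⁺ j) k → k ≡ j
  between-c⁻-c⁺ rk lk = ≮∧≯⇒≡ (R⁻⇒≮ rk) (L⁺⇒≯ lk)

  R⇒⊑c⁻ : ∀ c → R c k → c ⊑ c⁻ k
  R⇒⊑c⁻ c rk = ⊑-intro λ li → <⇒L⁻ (sep c _ _ li rk)

  R<⇒⊏c⁻ : ∀ c → R c i → i < k → c ⊏ c⁻ k
  R<⇒⊏c⁻ c ri i<k = ⊏-intro (R⇒⊑c⁻ c (R-up c ri i<k)) _ ri (<⇒L⁻ i<k)

  L⇒c⁻⊏ : ∀ d → L d k → c⁻ k ⊏ d
  L⇒c⁻⊏ d lk = ⊏-intro (⊑-intro λ li → L-down d lk (L⁻⇒< li)) _ (≮⇒R⁻ <-irr) lk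

  R⇒⊑c⁺ : ∀ c → R c k → c ⊑ c⁺ k
  R⇒⊑c⁺ c rk = ⊑-intro λ li → ≯⇒L⁺ λ k<i → L∧R-⊥ c li (R-up c rk k<i)

  L⇒c⁺⊑ : ∀ d → L d k → c⁺ k ⊑ d
  L⇒c⁺⊑ {k = k} d lk = ⊑-intro λ {i} li → lemma i (L⁺⇒≯ li)
    where
    lemma : ∀ i → ¬ k < i → L d i
    lemma i ¬k<i with compare i k
    ... | tri< i<k _ _ = L-down d lk i<k
    ... | tri≈ _ refl _ = lk
    ... | tri> _ _ k<i = ⊥-elim (¬k<i k<i)

  c⁺-mono : i < j → c⁺ i ⊑ c⁺ j
  c⁺-mono i<j = ⊑-intro λ lk → ≯⇒L⁺ λ j<k → L⁺⇒≯ lk (<-trans i<j j<k)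

  c⁻⊏⇒L : c⁻ m ⊏ d → L d m
  c⁻⊏⇒L {m = m} {d = d} (⊏-intro _ g rg lg) with compare m g
  ... | tri< m<g _ _ = L-down d lg m<g
  ... | tri≈ _ refl _ = lg
  ... | tri> _ _ g<m = ⊥-elim (R⁻⇒≮ rg g<m)

  Least : Ĵ → Pos → Set
  Least c m = R c m × (∀ k → R c k → ¬ k < m)

  least-c⁻ : Least (c⁻ j) j
  least-c⁻ = ≮⇒R⁻ <-irr , λ k rk → R⁻⇒≮ rk

  least⇒≋c⁻ : ∀ c → Least c m → c ≋ c⁻ m
  least⇒≋c⁻ c (rm , least) = ≋-intro (R⇒⊑c⁻ c rm) (⊑-intro λ {k} lk → lemma k (L⁻⇒< lk))
    where
    lemma : ∀ k → k < _ → L c k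
    lemma k k<m with L-or-R c k
    ... | inj₁ lk = lk
    ... | inj₂ rk = ⊥-elim (least k rk k<m)

  least-unique : ∀ c → Least c m → Least c k → m ≡ k
  least-unique {m = m} {k = k} c (rm , least-m) (rk , least-k) with compare m k
  ... | tri< m<k _ _ = ⊥-elim (least-k m rm m<k)
  ... | tri≈ _ m≡k _ = m≡k
  ... | tri> _ _ k<m = ⊥-elim (least-m k rk k<m)

  least-resp : c ≋ d → Least c m → Least d m
  least-resp (≋-intro c⊑d d⊑c) (rm , least) = ⊑-R d⊑c rm , λ k rk → least k (⊑-R c⊑d rk)

  ≋c⁻⇒least : c ≋ c⁻ m → Least c m
  ≋c⁻⇒least eq = least-resp (≋-sym eq) least-c⁻

  ≋c⁻⊏⇒L : c ≋ c⁻ m → c ⊏ d → L d m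
  ≋c⁻⊏⇒L eq c⊏d = c⁻⊏⇒L (⊑-⊏-trans (≋⇒⊒ eq) c⊏d)

  Covers : Ĵ → Ĵ → Set
  Covers p s = p ⊏ s × ¬ (∃ λ e → p ⊏ e × e ⊏ s)

  cover⇒c⁻c⁺ : Covers p s → ∃ λ m → p ≋ c⁻ m × s ≋ c⁺ m
  cover⇒c⁻c⁺ {p = p} {s = s} ((⊏-intro _ m rm lm) , nothing-between) =
    m , ≋-intro (R⇒⊑c⁻ p rm) (⊑-intro λ {k} lk → left-of-m k (L⁻⇒< lk))
      , ≋-intro (⊑-intro λ {k} lk → ≯⇒L⁺ (right-of-m k lk)) (L⇒c⁺⊑ s lm)
    where
    left-of-m : ∀ k → k < m → L p k
    left-of-m k k<m with L-or-R p k
    ... | inj₁ lk = lk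
    ... | inj₂ rk = ⊥-elim (nothing-between (c⁻ m , R<⇒⊏c⁻ p rk k<m , L⇒c⁻⊏ s lm))
    right-of-m : ∀ k → L s k → ¬ m < k
    right-of-m k lk m<k =
      nothing-between (c⁺ m , ⊏-intro (R⇒⊑c⁺ p rm) m rm (≯⇒L⁺ <-irr)
                            , ⊏-intro (L⇒c⁺⊑ s lm) k (<⇒R⁺ m<k) lk)

  c⁻-covered : Covers (c⁻ m) (c⁺ m)
  c⁻-covered {m = m} = ⊏-intro (R⇒⊑c⁺ (c⁻ m) (≮⇒R⁻ <-irr)) m (≮⇒R⁻ <-irr) (≯⇒L⁺ <-irr) , nothing-between
    where
    nothing-between : ¬ (∃ λ e → c⁻ m ⊏ e × e ⊏ c⁺ m)
    nothing-between (e , ⊏-intro _ i ri li , ⊏-intro _ i' ri' li') =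
      <-asym (sep e i i' li ri') (lemma (R⁻⇒≮ ri) (L⁺⇒≯ li'))
      where
      lemma : ¬ i < m → ¬ m < i' → i' < i
      lemma ¬i<m ¬m<i' with compare i' i
      ... | tri< i'<i _ _ = i'<i
      ... | tri≈ _ refl _ = ⊥-elim (L∧R-⊥ e li ri')
      ... | tri> _ _ i<i' with compare i m
      ...   | tri< i<m _ _ = ⊥-elim (¬i<m i<m)
      ...   | tri≈ _ refl _ = ⊥-elim (¬m<i' i<i')
      ...   | tri> _ _ m<i = ⊥-elim (¬m<i' (<-trans m<i i<i'))

  covers⇒HasSucc : Covers c d → HasSucc J c
  covers⇒HasSucc {d = d} (c⊏d , nb) =
    d , ⊏⇒<ᶜ c⊏d , λ (e , c<e , e<d) → nb (e , <ᶜ⇒⊏ c<e , <ᶜ⇒⊏ e<d)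

  HasSucc⇒covers : HasSucc J c → ∃ λ d → Covers c d
  HasSucc⇒covers (d , c<d , nb) = d , <ᶜ⇒⊏ c<d , λ (e , c⊏e , e⊏d) → nb (e , ⊏⇒<ᶜ c⊏e , ⊏⇒<ᶜ e⊏d)

  HasPred⇒covers : HasPred J c → ∃ λ d → Covers d c
  HasPred⇒covers (d , d<c , nb) = d , <ᶜ⇒⊏ d<c , λ (e , d⊏e , e⊏c) → nb (e , ⊏⇒<ᶜ d⊏e , ⊏⇒<ᶜ e⊏c)

  HasSucc⇒c⁻ : HasSucc J c → ∃ λ m → c ≋ c⁻ m
  HasSucc⇒c⁻ hs with cover⇒c⁻c⁺ (proj₂ (HasSucc⇒covers hs))
  ... | m , c≋c⁻m , _ = m , c≋c⁻m

  least⇒HasSucc : ∀ c → Least c m → HasSucc J c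
  least⇒HasSucc c lm with least⇒≋c⁻ c lm
  ... | ≋-intro c⊑c⁻ c⁻⊑c = covers⇒HasSucc (⊑-⊏-trans c⊑c⁻ (proj₁ c⁻-covered) ,
      λ (e , c⊏e , e⊏c⁺) → proj₂ c⁻-covered (e , ⊑-⊏-trans c⁻⊑c c⊏e , e⊏c⁺))

  ¬HasSucc⇒dense : ¬ HasSucc J c → c ⊏ d → ∃ λ e → c ⊏ e × e ⊏ d
  ¬HasSucc⇒dense ns c⊏d = byContradiction λ nb → ns (covers⇒HasSucc (c⊏d , nb))

  ¬HasPred⇒dense : ¬ HasPred J c → d ⊏ c → ∃ λ e → d ⊏ e × e ⊏ c
  ¬HasPred⇒dense {d = d} np d⊏c = byContradiction λ nb →
    np (d , ⊏⇒<ᶜ d⊏c , λ (e , d<e , e<c) → nb (e , <ᶜ⇒⊏ d<e , <ᶜ⇒⊏ e<c))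

  ¬HasSucc⇒noLeast : ∀ c → ¬ HasSucc J c → R c m → ∃ λ k → R c k × k < m
  ¬HasSucc⇒noLeast c ns rm =
    byContradiction λ ne → ns (least⇒HasSucc c (rm , λ k rk k<m → ne (k , rk , k<m)))

  record EventuallyR (c : Ĵ) (P : Ĵ → Set) : Set where
    constructor eventuallyR
    field
      bound : Ĵ
      c⊏bound : c ⊏ bound
      holds : ∀ e → c ⊏ e → e ⊏ bound → P e

  record EventuallyL (c : Ĵ) (P : Ĵ → Set) : Set where
    constructor eventuallyL
    field
      bound : Ĵ
      bound⊏c : bound ⊏ c
      holds : ∀ e → bound ⊏ e → e ⊏ c → P e

  evR-map : {Q : Ĵ → Set} → (∀ e → P e → Q e) → EventuallyR c P → EventuallyR c Q
  evR-map f (eventuallyR b c⊏b h) = eventuallyR b c⊏b λ e c⊏e e⊏b → f e (h e c⊏e e⊏b)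

  evL-map : {Q : Ĵ → Set} → (∀ e → P e → Q e) → EventuallyL c P → EventuallyL c Q
  evL-map f (eventuallyL b b⊏c h) = eventuallyL b b⊏c λ e b⊏e e⊏c → f e (h e b⊏e e⊏c)

  evR-∧ : {Q : Ĵ → Set} → EventuallyR c P → EventuallyR c Q → EventuallyR c (λ e → P e × Q e)
  evR-∧ (eventuallyR b c⊏b h) (eventuallyR b' c⊏b' h') with ⊑-total b b'
  ... | inj₁ b⊑b' = eventuallyR b c⊏b λ e c⊏e e⊏b → h e c⊏e e⊏b , h' e c⊏e (⊏-⊑-trans e⊏b b⊑b')
  ... | inj₂ b'⊏b = eventuallyR b' c⊏b' λ e c⊏e e⊏b' → h e c⊏e (⊏-trans e⊏b' b'⊏b) , h' e c⊏e e⊏b'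

  evL-∧ : {Q : Ĵ → Set} → EventuallyL c P → EventuallyL c Q → EventuallyL c (λ e → P e × Q e)
  evL-∧ (eventuallyL b b⊏c h) (eventuallyL b' b'⊏c h') with ⊑-total b b'
  ... | inj₁ b⊑b' = eventuallyL b' b'⊏c λ e b'⊏e e⊏c → h e (⊑-⊏-trans b⊑b' b'⊏e) e⊏c , h' e b'⊏e e⊏c
  ... | inj₂ b'⊏b = eventuallyL b b⊏c λ e b⊏e e⊏c → h e b⊏e e⊏c , h' e (⊏-trans b'⊏b b⊏e) e⊏c

  evR-always : ¬ _≈ᶜ_ J c (cmax J) → (∀ e → P e) → EventuallyR c P
  evR-always ne h = eventuallyR (cmax J) (≉cmax⇒⊏cmax ne) λ e _ _ → h e

  evL-always : ¬ _≈ᶜ_ J c (cmin J) → (∀ e → P e) → EventuallyL c P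
  evL-always ne h = eventuallyL (cmin J) (≉cmin⇒cmin⊏ ne) λ e _ _ → h e

  evR-witness : ¬ HasSucc J c → EventuallyR c P → ∃ λ e → c ⊏ e × P e
  evR-witness ns (eventuallyR b c⊏b h) with ¬HasSucc⇒dense ns c⊏b
  ... | e , c⊏e , e⊏b = e , c⊏e , h e c⊏e e⊏b

  module Limits {Q : Set} (f : Ĵ → Q) where
    ¬limR⇒evR : {q : Q} → ¬ limR J f c q → EventuallyR c (λ e → ¬ f e ≡ q)
    ¬limR⇒evR nl with ¬∀⇒∃¬ nl
    ... | d , nd = eventuallyR d (<ᶜ⇒⊏ (byContradiction λ ncd → nd λ cd → ⊥-elim (ncd cd)))
                     λ e c⊏e e⊏d eq → nd λ _ → e , ⊏⇒<ᶜ c⊏e , ⊏⇒<ᶜ e⊏d , eq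

    ¬limL⇒evL : {q : Q} → ¬ limL J f c q → EventuallyL c (λ e → ¬ f e ≡ q)
    ¬limL⇒evL nl with ¬∀⇒∃¬ nl
    ... | d , nd = eventuallyL d (<ᶜ⇒⊏ (byContradiction λ ndc → nd λ dc → ⊥-elim (ndc dc)))
                     λ e d⊏e e⊏c eq → nd λ _ → e , ⊏⇒<ᶜ d⊏e , ⊏⇒<ᶜ e⊏c , eq

    limR-meets : {q : Q} → limR J f c q → EventuallyR c P → ∃ λ e → P e × f e ≡ q
    limR-meets lim (eventuallyR b c⊏b h) with lim b (⊏⇒<ᶜ c⊏b)
    ... | e , c<e , e<b , eq = e , h e (<ᶜ⇒⊏ c<e) (<ᶜ⇒⊏ e<b) , eq

    limL-meets : {q : Q} → limL J f c q → EventuallyL c P → ∃ λ e → P e × f e ≡ q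
    limL-meets lim (eventuallyL b b⊏c h) with lim b (⊏⇒<ᶜ b⊏c)
    ... | e , b<e , e<c , eq = e , h e (<ᶜ⇒⊏ b<e) (<ᶜ⇒⊏ e<c) , eq

    evR⇒limR : {q : Q} → ¬ HasSucc J c → EventuallyR c (λ e → f e ≡ q) → limR J f c q
    evR⇒limR ns (eventuallyR b c⊏b h) d c<d with ⊑-total b d
    ... | inj₁ b⊑d with ¬HasSucc⇒dense ns c⊏b
    ...   | e , c⊏e , e⊏b = e , ⊏⇒<ᶜ c⊏e , ⊏⇒<ᶜ (⊏-⊑-trans e⊏b b⊑d) , h e c⊏e e⊏b
    evR⇒limR ns (eventuallyR b c⊏b h) d c<d | inj₂ d⊏b with ¬HasSucc⇒dense ns (<ᶜ⇒⊏ c<d)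
    ...   | e , c⊏e , e⊏d = e , ⊏⇒<ᶜ c⊏e , ⊏⇒<ᶜ e⊏d , h e c⊏e (⊏-trans e⊏d d⊏b)

    evL⇒limL : {q : Q} → ¬ HasPred J c → EventuallyL c (λ e → f e ≡ q) → limL J f c q
    evL⇒limL np (eventuallyL b b⊏c h) d d<c with ⊑-total b d
    ... | inj₂ d⊏b with ¬HasPred⇒dense np b⊏c
    ...   | e , b⊏e , e⊏c = e , ⊏⇒<ᶜ (⊏-trans d⊏b b⊏e) , ⊏⇒<ᶜ e⊏c , h e b⊏e e⊏c
    evL⇒limL np (eventuallyL b b⊏c h) d d<c | inj₁ b⊑d with ¬HasPred⇒dense np (<ᶜ⇒⊏ d<c)
    ...   | e , d⊏e , e⊏c = e , ⊏⇒<ᶜ d⊏e , ⊏⇒<ᶜ e⊏c , h e (⊑-⊏-trans b⊑d d⊏e) e⊏c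

  -- The supremum
  -- of the positions i such that Inv holds on [c, c_i^+] is a cut; the
  -- hypotheses say that Inv holds there and that it cannot be exceeded.
  module ContinuousInduction
      (Inv : Ĵ → Set) (Inv-resp : ∀ {a b} → a ≋ b → Inv a → Inv b)
      (c : Ĵ) (Inv-c : Inv c)
      (step : ∀ s → c ⊏ s → (∀ e → c ⊑ e → e ⊏ s → Inv e) → Inv s)
      (extend : ∀ s → c ⊑ s → (∀ e → c ⊑ e → e ⊑ s → Inv e) →
                ¬ _≈ᶜ_ J s (cmax J) → ¬ HasSucc J s → EventuallyR s Inv)
      where

    Reached : Pos → Set
    Reached i = L c i ⊎ (∀ e → c ⊑ e → e ⊑ c⁺ i → Inv e)

    reached-down : i < j → Reached j → Reached i
    reached-down i<j (inj₁ lj) = inj₁ (L-down c lj i<j)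
    reached-down i<j (inj₂ h) = inj₂ λ e c⊑e e⊑c⁺i → h e c⊑e (⊑-trans e⊑c⁺i (c⁺-mono i<j))

    frontier : Ĵ
    frontier = record { left = λ i → decide (Reached i) ; sep = separated }
      where
      separated : ∀ k l → decide (Reached k) ≡ true → decide (Reached l) ≡ false → k < l
      separated k l rk nl with compare k l
      ... | tri< k<l _ _ = k<l
      ... | tri≈ _ refl _ = ⊥-elim (true≢false (trans (sym rk) nl))
      ... | tri> _ _ l<k =
        ⊥-elim (true≢false (trans (sym (decide-true (reached-down l<k (decide-sound rk)))) nl))

    c⊑frontier : c ⊑ frontier
    c⊑frontier = ⊑-intro λ li → decide-true (inj₁ li)

    below : ∀ e → c ⊑ e → e ⊏ frontier → Inv e
    below e c⊑e (⊏-intro _ i re lf) with decide-sound lf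
    ... | inj₁ lc = ⊥-elim (L∧R-⊥ e (⊑-L c⊑e lc) re)
    ... | inj₂ h = h e c⊑e (R⇒⊑c⁺ e re)

    Inv-frontier : Inv frontier
    Inv-frontier with ⊑-total frontier c
    ... | inj₁ f⊑c = Inv-resp (≋-intro c⊑frontier f⊑c) Inv-c
    ... | inj₂ c⊏f = step frontier c⊏f below

    upto : ∀ e → c ⊑ e → e ⊑ frontier → Inv e
    upto e c⊑e e⊑f with ⊑-total frontier e
    ... | inj₁ f⊑e = Inv-resp (≋-intro f⊑e e⊑f) Inv-frontier
    ... | inj₂ e⊏f = below e c⊑e e⊏f

    unreached : R frontier i → (∀ e → frontier ⊏ e → e ⊑ c⁺ i → Inv e) → ⊥
    unreached ri h = true≢false (trans (sym (decide-true reached)) ri)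
      where
      reached : Reached _
      reached = inj₂ λ e c⊑e e⊑c⁺i → [ upto e c⊑e , (λ f⊏e → h e f⊏e e⊑c⁺i) ]′ (⊑-total e frontier)

    nothing-beyond : frontier ⊏ e → ⊥
    nothing-beyond f⊏e with em {HasSucc J frontier}
    ... | yes hs with HasSucc⇒covers hs
    ...   | t , f⊏t@(⊏-intro _ i ri lt) , nb = unreached ri λ e f⊏e e⊑c⁺i →
              Inv-resp (≋-intro (t⊑ e f⊏e) (⊑-trans e⊑c⁺i (L⇒c⁺⊑ t lt))) Inv-t
      where
      t⊑ : ∀ e → frontier ⊏ e → t ⊑ e
      t⊑ e f⊏e with ⊑-total t e
      ... | inj₁ t⊑e = t⊑e
      ... | inj₂ e⊏t = ⊥-elim (nb (e , f⊏e , e⊏t))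
      Inv-t : Inv t
      Inv-t = step t (⊑-⊏-trans c⊑frontier f⊏t) λ e c⊑e e⊏t →
                upto e c⊑e ([ (λ e⊑f → e⊑f) , (λ f⊏e → ⊥-elim (nb (e , f⊏e , e⊏t))) ]′ (⊑-total e frontier))
    nothing-beyond f⊏e | no ns
      with extend frontier c⊑frontier upto (⊏⇒≉cmax f⊏e) ns
    ... | eventuallyR b f⊏b h with ¬HasSucc⇒dense ns f⊏b
    ...   | e₁ , ⊏-intro _ i ri li , e₁⊏b = unreached ri λ e f⊏e e⊑c⁺i →
              h e f⊏e (⊑-⊏-trans (⊑-trans e⊑c⁺i (L⇒c⁺⊑ e₁ li)) e₁⊏b)

    above : ∀ e → c ⊑ e → Inv e
    above e c⊑e with ⊑-total e frontier
    ... | inj₁ e⊑f = upto e c⊑e e⊑f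
    ... | inj₂ f⊏e = ⊥-elim (nothing-beyond f⊏e)

  continuousInduction :
    (Inv : Ĵ → Set) → (∀ {a b} → a ≋ b → Inv a → Inv b) →
    ∀ c → Inv c →
    (∀ s → c ⊏ s → (∀ e → c ⊑ e → e ⊏ s → Inv e) → Inv s) →
    (∀ s → c ⊑ s → (∀ e → c ⊑ e → e ⊑ s → Inv e) →
       ¬ _≈ᶜ_ J s (cmax J) → ¬ HasSucc J s → EventuallyR s Inv) →
    ∀ e → c ⊑ e → Inv e
  continuousInduction = ContinuousInduction.above

  module StateLimits (f : Ĵ → St) where
    open Limits f

    byState : {S : St → Set} (q : St) → (q ≡ q0 → S q0) × (q ≡ q1 → S q1) × (q ≡ q2 → S q2) ×
              (q ≡ q3 → S q3) × (q ≡ q4 → S q4) → S q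
    byState q0 (h , _) = h refl
    byState q1 (_ , h , _) = h refl
    byState q2 (_ , _ , h , _) = h refl
    byState q3 (_ , _ , _ , h , _) = h refl
    byState q4 (_ , _ , _ , _ , h) = h refl

    evR-only : (S : St → Set) → ¬ _≈ᶜ_ J c (cmax J) → (∀ q → ¬ S q → ¬ limR J f c q) →
               EventuallyR c (λ e → S (f e))
    evR-only {c = c} S ne excluded =
      evR-map (λ e → byState {S} (f e)) (evR-∧ (at q0) (evR-∧ (at q1) (evR-∧ (at q2) (evR-∧ (at q3) (at q4)))))
      where
      at : ∀ q → EventuallyR c (λ e → f e ≡ q → S q)
      at q with em {S q}
      ... | yes sq = evR-always ne λ _ _ → sq
      ... | no ¬sq = evR-map (λ e ≢q ≡q → ⊥-elim (≢q ≡q)) (¬limR⇒evR (excluded q ¬sq))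

    evL-only : (S : St → Set) → ¬ _≈ᶜ_ J c (cmin J) → (∀ q → ¬ S q → ¬ limL J f c q) →
               EventuallyL c (λ e → S (f e))
    evL-only {c = c} S ne excluded =
      evL-map (λ e → byState {S} (f e)) (evL-∧ (at q0) (evL-∧ (at q1) (evL-∧ (at q2) (evL-∧ (at q3) (at q4)))))
      where
      at : ∀ q → EventuallyL c (λ e → f e ≡ q → S q)
      at q with em {S q}
      ... | yes sq = evL-always ne λ _ _ → sq
      ... | no ¬sq = evL-map (λ e ≢q ≡q → ⊥-elim (≢q ≡q)) (¬limL⇒evL (excluded q ¬sq))

    -- A right limit set away from c_max is nonempty, the states being finitely many.
    limR-inhabited : ¬ HasSucc J c → ¬ _≈ᶜ_ J c (cmax J) → ∃ λ q → limR J f c q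
    limR-inhabited {c = c} ns ne = byContradiction λ none →
      proj₂ (proj₂ (evR-witness ns (nowhere none)))
      where
      nowhere : ¬ (∃ λ q → limR J f c q) → EventuallyR c (λ _ → ⊥)
      nowhere none = evR-only (λ _ → ⊥) ne λ q _ lim → none (q , lim)

    limR-is : {q : St} → ¬ HasSucc J c → EventuallyR c (λ e → f e ≡ q) → limR J f c ≐ (λ t → t ≡ q)
    limR-is ns ev t = mk⇔ (λ lim → let (e , ≡q , ≡t) = limR-meets lim ev in trans (sym ≡t) ≡q)
                          (λ { refl → evR⇒limR ns ev })

    limL-is : {q : St} → ¬ HasPred J c → EventuallyL c (λ e → f e ≡ q) → limL J f c ≐ (λ t → t ≡ q)
    limL-is np ev t = mk⇔ (λ lim → let (e , ≡q , ≡t) = limL-meets lim ev in trans (sym ≡t) ≡q)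
                          (λ { refl → evL⇒limL np ev })

module AutomatonFacts where

  out-true-states : ∀ q → outLetter q ≡ true → q ≡ q0 ⊎ q ≡ q1 ⊎ q ≡ q2
  out-true-states q0 _ = inj₁ refl
  out-true-states q1 _ = inj₂ (inj₁ refl)
  out-true-states q2 _ = inj₂ (inj₂ refl)

  out-false-states : ∀ q → outLetter q ≡ false → q ≡ q3 ⊎ q ≡ q4
  out-false-states q3 _ = inj₁ refl
  out-false-states q4 _ = inj₂ refl

  reads-y⇒out-true : ∀ q → proj₂ (inLetter q) ≡ true → outLetter q ≡ true
  reads-y⇒out-true q0 _ = refl
  reads-y⇒out-true q1 _ = refl

  bad-stays-bad : ∀ p q → outLetter p ≡ false → proj₁ (inLetter p) ≡ true →
                  ¬ Forbidden p q → outLetter q ≡ false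
  bad-stays-bad q4 q0 _ _ nf = ⊥-elim (nf f40)
  bad-stays-bad q4 q1 _ _ nf = ⊥-elim (nf f41)
  bad-stays-bad q4 q2 _ _ nf = ⊥-elim (nf f42)
  bad-stays-bad q4 q3 _ _ _ = refl
  bad-stays-bad q4 q4 _ _ _ = refl

  q2-stays-good : ∀ q → ¬ Forbidden q2 q → outLetter q ≡ true
  q2-stays-good q0 _ = refl
  q2-stays-good q1 _ = refl
  q2-stays-good q2 _ = refl
  q2-stays-good q3 nf = ⊥-elim (nf f23)
  q2-stays-good q4 nf = ⊥-elim (nf f24)

  leftU-⊆q4 : ∀ {P q} → leftU P q → (∀ t → P t → t ≡ q4) → outLetter q ≡ false
  leftU-⊆q4 (inj₁ (inj₁ P0)) ⊆q4 with ⊆q4 q0 P0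
  ... | ()
  leftU-⊆q4 (inj₁ (inj₂ (inj₁ P1))) ⊆q4 with ⊆q4 q1 P1
  ... | ()
  leftU-⊆q4 (inj₁ (inj₂ (inj₂ P3))) ⊆q4 with ⊆q4 q3 P3
  ... | ()
  leftU-⊆q4 (inj₂ (inj₁ (P≐q2 , _))) ⊆q4 with ⊆q4 q2 (Equivalence.from (P≐q2 q2) refl)
  ... | ()
  leftU-⊆q4 (inj₂ (inj₂ (_ , inj₁ refl))) _ = refl
  leftU-⊆q4 (inj₂ (inj₂ (_ , inj₂ refl))) _ = refl

  leftU-⊆q2 : ∀ {P q} → leftU P q → (∀ t → P t → t ≡ q2) → outLetter q ≡ true
  leftU-⊆q2 (inj₁ (inj₁ P0)) ⊆q2 with ⊆q2 q0 P0
  ... | ()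
  leftU-⊆q2 (inj₁ (inj₂ (inj₁ P1))) ⊆q2 with ⊆q2 q1 P1
  ... | ()
  leftU-⊆q2 (inj₁ (inj₂ (inj₂ P3))) ⊆q2 with ⊆q2 q3 P3
  ... | ()
  leftU-⊆q2 (inj₂ (inj₁ (_ , inj₁ refl))) _ = refl
  leftU-⊆q2 (inj₂ (inj₁ (_ , inj₂ (inj₁ refl)))) _ = refl
  leftU-⊆q2 (inj₂ (inj₁ (_ , inj₂ (inj₂ refl)))) _ = refl
  leftU-⊆q2 (inj₂ (inj₂ (P≐q4 , _))) ⊆q2 with ⊆q2 q4 (Equivalence.from (P≐q4 q4) refl)
  ... | ()

  rightU-source : ∀ {P q} → rightU q P → q ≡ q2 ⊎ q ≡ q4
  rightU-source (inj₁ (refl , _)) = inj₁ refl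
  rightU-source (inj₂ (inj₁ (refl , _))) = inj₂ refl
  rightU-source (inj₂ (inj₂ (refl , _))) = inj₂ refl

  rightU-q2 : ∀ {P} → rightU q2 P → ∀ t → P t → t ≡ q0 ⊎ t ≡ q2
  rightU-q2 (inj₁ (_ , inj₁ P≐q0)) t Pt = inj₁ (Equivalence.to (P≐q0 t) Pt)
  rightU-q2 (inj₁ (_ , inj₂ (inj₁ P≐q2))) t Pt = inj₂ (Equivalence.to (P≐q2 t) Pt)
  rightU-q2 (inj₁ (_ , inj₂ (inj₂ P≐q02))) t Pt = Equivalence.to (P≐q02 t) Pt
  rightU-q2 (inj₂ (inj₁ (() , _)))
  rightU-q2 (inj₂ (inj₂ (() , _)))

  rightU-q4 : ∀ {P} → rightU q4 P → (P q1 ⊎ P q3) ⊎ (∀ t → P t → t ≡ q4)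
  rightU-q4 (inj₁ (() , _))
  rightU-q4 (inj₂ (inj₁ (_ , P13))) = inj₁ P13
  rightU-q4 (inj₂ (inj₂ (_ , P≐q4))) = inj₂ λ t Pt → Equivalence.to (P≐q4 t) Pt

  out-false∧reads-x⇒q4 : ∀ q → outLetter q ≡ false → proj₁ (inLetter q) ≡ true → q ≡ q4
  out-false∧reads-x⇒q4 q4 _ _ = refl

  out-true∧¬reads-y⇒q2 : ∀ q → outLetter q ≡ true → proj₂ (inLetter q) ≡ false → q ≡ q2
  out-true∧¬reads-y⇒q2 q2 _ _ = refl

  -- q0 and q2, the possible right limits of q2, read x = 1 and output 1.
  q0q2-reads-x∧out : ∀ q → q ≡ q0 ⊎ q ≡ q2 → proj₁ (inLetter q) ≡ true × outLetter q ≡ true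
  q0q2-reads-x∧out q0 _ = refl , refl
  q0q2-reads-x∧out q2 _ = refl , refl
  q0q2-reads-x∧out q1 (inj₁ ())
  q0q2-reads-x∧out q1 (inj₂ ())
  q0q2-reads-x∧out q3 (inj₁ ())
  q0q2-reads-x∧out q3 (inj₂ ())
  q0q2-reads-x∧out q4 (inj₁ ())
  q0q2-reads-x∧out q4 (inj₂ ())

  q2q4-read-10 : ∀ q → q ≡ q2 ⊎ q ≡ q4 → inLetter q ≡ (true , false)
  q2q4-read-10 q (inj₁ refl) = refl
  q2q4-read-10 q (inj₂ refl) = refl

  out1∧reads-x⇒q0q2 : ∀ q → outLetter q ≡ true → proj₁ (inLetter q) ≡ true → q ≡ q0 ⊎ q ≡ q2
  out1∧reads-x⇒q0q2 q0 _ _ = inj₁ refl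
  out1∧reads-x⇒q0q2 q2 _ _ = inj₂ refl

  forbidden-source : ∀ {p q} → Forbidden p q → inLetter p ≡ (true , false)
  forbidden-source f23 = refl
  forbidden-source f24 = refl
  forbidden-source f40 = refl
  forbidden-source f41 = refl
  forbidden-source f42 = refl

  forbidden-out : ∀ {p q} → Forbidden p q → ¬ outLetter p ≡ outLetter q
  forbidden-out f23 ()
  forbidden-out f24 ()
  forbidden-out f40 ()
  forbidden-out f41 ()
  forbidden-out f42 ()

  avoid013 : ∀ {P : St → Set} → ¬ (P q0 ⊎ P q1 ⊎ P q3) → ∀ q → ¬ inLetter q ≡ (true , false) → ¬ P q
  avoid013 ¬P q0 _ P0 = ¬P (inj₁ P0)
  avoid013 ¬P q1 _ P1 = ¬P (inj₂ (inj₁ P1))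
  avoid013 ¬P q2 ¬10 _ = ¬10 refl
  avoid013 ¬P q3 _ P3 = ¬P (inj₂ (inj₂ P3))
  avoid013 ¬P q4 ¬10 _ = ¬10 refl

  avoid13 : ∀ {P : St → Set} → ¬ (P q1 ⊎ P q3) → ∀ q → ¬ proj₁ (inLetter q) ≡ true → ¬ P q
  avoid13 ¬P q0 ¬x _ = ¬x refl
  avoid13 ¬P q1 _ P1 = ¬P (inj₁ P1)
  avoid13 ¬P q2 ¬x _ = ¬x refl
  avoid13 ¬P q3 _ P3 = ¬P (inj₂ P3)
  avoid13 ¬P q4 ¬x _ = ¬x refl

  -- The state at a cut without successor, according to its output g.
  limitState : Bool → St
  limitState true = q2
  limitState false = q4

  limitState-out : ∀ g → outLetter (limitState g) ≡ g
  limitState-out true = refl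
  limitState-out false = refl

  limitState-reads : ∀ g → inLetter (limitState g) ≡ (true , false)
  limitState-reads true = refl
  limitState-reads false = refl

  reads-10⇒limitState : ∀ q → inLetter q ≡ (true , false) → q ≡ limitState (outLetter q)
  reads-10⇒limitState q2 _ = refl
  reads-10⇒limitState q4 _ = refl

  -- The state at a cut c_m^- when m carries the letter (a,b) and the output
  -- should be g (g matters only for the letter (1,0)).
  readState : Bool → Bool → Bool → St
  readState true true _ = q0
  readState false true _ = q1
  readState false false _ = q3
  readState true false g = limitState g

  readState-reads : ∀ a b g → inLetter (readState a b g) ≡ (a , b)
  readState-reads true true _ = refl
  readState-reads false true _ = refl
  readState-reads false false _ = refl
  readState-reads true false true = refl
  readState-reads true false false = refl

  leftU-limitState : ∀ {P q} g → P ≐ (λ t → t ≡ limitState g) → outLetter q ≡ g → leftU P q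
  leftU-limitState {q = q} true P≐ out1 = inj₂ (inj₁ (P≐ , out-true-states q out1))
  leftU-limitState {q = q} false P≐ out0 = inj₂ (inj₂ (P≐ , out-false-states q out0))

  rightU-q2-of : ∀ {P} → Dec (P q0) → Dec (P q2) → (P q0 ⊎ P q2) →
                 (∀ t → P t → t ≡ q0 ⊎ t ≡ q2) → rightU q2 P
  rightU-q2-of {P} (yes P0) (yes P2) _ ⊆q02 = inj₁ (refl , inj₂ (inj₂ λ t → mk⇔ (⊆q02 t) back))
    where
    back : ∀ {t} → t ≡ q0 ⊎ t ≡ q2 → P t
    back (inj₁ refl) = P0
    back (inj₂ refl) = P2
  rightU-q2-of {P} (yes P0) (no ¬P2) _ ⊆q02 = inj₁ (refl , inj₁ λ t → mk⇔ (only t) λ { refl → P0 })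
    where
    only : ∀ t → P t → t ≡ q0
    only t Pt with ⊆q02 t Pt
    ... | inj₁ t≡q0 = t≡q0
    ... | inj₂ refl = ⊥-elim (¬P2 Pt)
  rightU-q2-of {P} (no ¬P0) (yes P2) _ ⊆q02 = inj₁ (refl , inj₂ (inj₁ λ t → mk⇔ (only t) λ { refl → P2 }))
    where
    only : ∀ t → P t → t ≡ q2
    only t Pt with ⊆q02 t Pt
    ... | inj₁ refl = ⊥-elim (¬P0 Pt)
    ... | inj₂ t≡q2 = t≡q2
  rightU-q2-of (no ¬P0) (no ¬P2) (inj₁ P0) _ = ⊥-elim (¬P0 P0)
  rightU-q2-of (no ¬P0) (no ¬P2) (inj₂ P2) _ = ⊥-elim (¬P2 P2)

module UntilOnCuts (em : ExcludedMiddle 0ℓ) (J : LinearOrder)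
                   (x y : LinearOrder.Carrier J → Bool) where
  open Classical em
  open CutOrder em J
  open LinearOrder J using (_<_; compare) renaming (Carrier to Pos)
  open AutomatonFacts

  Good : Ĵ → Set
  Good c = ∃ λ l → R c l × y l ≡ true × (∀ k → R c k → k < l → x k ≡ true)

  until⇔good : Until J x y j ⇔ Good (c⁺ j)
  until⇔good = mk⇔ (λ (l , j<l , yl , xs) → l , <⇒R⁺ j<l , yl , λ k rk k<l → xs k (R⁺⇒< rk) k<l)
                   (λ (l , rl , yl , xs) → l , R⁺⇒< rl , yl , λ k j<k k<l → xs k (<⇒R⁺ j<k) k<l)

  good-resp : c ≋ d → Good c → Good d
  good-resp (≋-intro c⊑d d⊑c) (l , rl , yl , xs) = l , ⊑-R d⊑c rl , yl , λ k rk → xs k (⊑-R c⊑d rk)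

  good-extend : e ⊑ c → (∀ k → R e k → L c k → x k ≡ true) → Good c → Good e
  good-extend {e = e} {c = c} e⊑c x-between (l , rl , yl , xs) = l , ⊑-R e⊑c rl , yl , xs′
    where
    xs′ : ∀ k → R e k → k < l → x k ≡ true
    xs′ k rk k<l with L-or-R c k
    ... | inj₁ lk = x-between k rk lk
    ... | inj₂ rk′ = xs k rk′ k<l

  good-restrict : e ⊑ c → (∀ k → R e k → L c k → y k ≡ false) → Good e → Good c
  good-restrict {e = e} {c = c} e⊑c y-between (l , rl , yl , xs) =
    l , rcl , yl , λ k rk → xs k (⊑-R e⊑c rk)
    where
    rcl : R c l
    rcl with L-or-R c l
    ... | inj₁ lc = ⊥-elim (true≢false (trans (sym yl) (y-between l rl lc)))
    ... | inj₂ rc = rc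

  module Correctness (r : AcceptingRun AU J (λ j → x j , y j)) where
    open Limits (ρ r)
    open StateLimits (ρ r)

    f : Ĵ → St
    f = ρ r

    f-resp : c ≋ d → f c ≡ f d
    f-resp {c = c} {d = d} eq = resp r c d (≋⇒≈ᶜ eq)

    letter : ∀ m → (x m , y m) ≡ inLetter (f (c⁻ m))
    letter m = proj₁ (proj₂ (succ r m))

    -- Cuts without successor carry q2 or q4 (the final state, or a source of
    -- a right limit transition); all other states sit at some c_m^- and
    -- read the letter of m.
    noSucc-state : ∀ e → ¬ HasSucc J e → f e ≡ q2 ⊎ f e ≡ q4
    noSucc-state e ns with em {_≈ᶜ_ J e (cmax J)}
    ... | yes e≈max = inj₂ (trans (resp r e (cmax J) e≈max) (fin r))
    ... | no e≉max = rightU-source (limRight r e e≉max ns)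

    reads-position : ∀ e → ¬ inLetter (f e) ≡ (true , false) →
                     ∃ λ m → e ≋ c⁻ m × (x m , y m) ≡ inLetter (f e)
    reads-position e ¬10 with em {HasSucc J e}
    ... | yes hs = let (m , e≋) = HasSucc⇒c⁻ hs in
                   m , e≋ , trans (letter m) (cong inLetter (f-resp (≋-sym e≋)))
    ... | no ns = ⊥-elim (¬10 (q2q4-read-10 (f e) (noSucc-state e ns)))

    y-true-at : ∀ e → proj₂ (inLetter (f e)) ≡ true → ∃ λ m → e ≋ c⁻ m × y m ≡ true
    y-true-at e yt with reads-position e (λ eq → true≢false (trans (sym yt) (cong proj₂ eq)))
    ... | m , e≋ , xy = m , e≋ , trans (cong proj₂ xy) yt

    x-false-at : ∀ e → proj₁ (inLetter (f e)) ≡ false → ∃ λ m → e ≋ c⁻ m × x m ≡ false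
    x-false-at e xf with reads-position e (λ eq → true≢false (trans (sym (cong proj₁ eq)) xf))
    ... | m , e≋ , xy = m , e≋ , trans (cong proj₁ xy) xf

    arrival : c ⊏ s → (∃ λ p → c ⊑ p × p ⊏ s × ¬ Forbidden (f p) (f s))
                    ⊎ (¬ HasPred J s × leftU (limL J f s) (f s))
    arrival {c = c} {s = s} c⊏s with em {HasPred J s}
    ... | no np = inj₂ (np , limLeft r s (⊏⇒≉cmin c⊏s) np)
    ... | yes hp with HasPred⇒covers hp
    ...   | p , p⊏s , nb with cover⇒c⁻c⁺ (p⊏s , nb) | ⊑-total c p
    ...     | m , p≋ , s≋ | inj₁ c⊑p =
                inj₁ (p , c⊑p , p⊏s , subst₂ (λ u v → ¬ Forbidden u v)
                                              (f-resp (≋-sym p≋)) (f-resp (≋-sym s≋)) (proj₁ (succ r m)))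
    ...     | _ | inj₂ p⊏c = ⊥-elim (nb (c , p⊏c , c⊏s))

    limL-from : {S : St → Set} → c ⊏ s → (∀ e → c ⊑ e → e ⊏ s → S (f e)) → ∀ t → limL J f s t → S t
    limL-from {S = S} c⊏s h t lim with limL-meets lim (eventuallyL _ c⊏s λ e c⊏e e⊏s → h e (⊏⇒⊑ c⊏e) e⊏s)
    ... | e , Sfe , fe≡t = subst S fe≡t Sfe

    -- Good c forces output 1 at c: were it 0, output 0 would persist (by
    -- continuous induction) up to c_l^-, where the state reads y = 1.
    module OutputOfGood (c : Ĵ) (l : Pos) (rl : R c l) (yl : y l ≡ true)
                        (xs : ∀ k → R c k → k < l → x k ≡ true) where
      reads-x : ∀ e → c ⊑ e → e ⊏ c⁻ l → proj₁ (inLetter (f e)) ≡ true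
      reads-x e c⊑e e⊏l with bool-cases (proj₁ (inLetter (f e)))
      ... | inj₁ xt = xt
      ... | inj₂ xf with x-false-at e xf
      ...   | m , e≋ , xm =
        ⊥-elim (true≢false (trans (sym (xs m (⊑-R c⊑e (proj₁ (≋c⁻⇒least e≋))) (L⁻⇒< (≋c⁻⊏⇒L e≋ e⊏l)))) xm))

      Bad : Ĵ → Set
      Bad e = e ⊑ c⁻ l → outLetter (f e) ≡ false

      bad-resp : a ≋ b → Bad a → Bad b
      bad-resp eq h b⊑l = trans (cong outLetter (f-resp (≋-sym eq))) (h (⊑-trans (≋⇒⊑ eq) b⊑l))

      -- Output 0 survives a successor transition reading x = 1 (that is, from
      -- q4), and a left limit transition, whose limit set is then ⊆ {q4}.
      bad-step : ∀ s → c ⊏ s → (∀ e → c ⊑ e → e ⊏ s → Bad e) → Bad s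
      bad-step s c⊏s H s⊑l with arrival c⊏s
      ... | inj₁ (p , c⊑p , p⊏s , nf) =
        bad-stays-bad (f p) (f s) (H p c⊑p p⊏s (⊑-trans (⊏⇒⊑ p⊏s) s⊑l)) (reads-x p c⊑p (⊏-⊑-trans p⊏s s⊑l)) nf
      ... | inj₂ (_ , arrive) = leftU-⊆q4 arrive (limL-from c⊏s λ e c⊑e e⊏s →
        out-false∧reads-x⇒q4 (f e) (H e c⊑e e⊏s (⊑-trans (⊏⇒⊑ e⊏s) s⊑l)) (reads-x e c⊑e (⊏-⊑-trans e⊏s s⊑l)))

      -- After a cut without successor (in state q4, as q2 has output 1) the
      -- run stays in q4: reaching q1 or q3 before c_l^- would read x = 0.
      bad-extend : ∀ s → c ⊑ s → (∀ e → c ⊑ e → e ⊑ s → Bad e) →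
                   ¬ _≈ᶜ_ J s (cmax J) → ¬ HasSucc J s → EventuallyR s Bad
      bad-extend s c⊑s H ne ns with ⊑-total s (c⁻ l)
      ... | inj₂ l⊏s = eventuallyR (cmax J) (≉cmax⇒⊏cmax ne) λ e s⊏e _ e⊑l → ⊥-elim (⊏⇒⋣ (⊏-trans l⊏s s⊏e) e⊑l)
      ... | inj₁ s⊑l with noSucc-state s ns
      ...   | inj₁ fs≡q2 = ⊥-elim (true≢false (trans (sym (cong outLetter fs≡q2)) (H s c⊑s ⊑-refl s⊑l)))
      ...   | inj₂ fs≡q4 with rightU-q4 (subst (λ q → rightU q (limR J f s)) fs≡q4 (limRight r s ne ns))
      ...     | inj₂ ⊆q4 = evR-map (λ e fe≡q4 _ → cong outLetter fe≡q4)
                             (evR-only (λ q → q ≡ q4) ne λ q ≢q4 lim → ≢q4 (⊆q4 q lim))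
      ...     | inj₁ lim13 = ⊥-elim (no-x-false lim13)
        where
        s⊏l : s ⊏ c⁻ l
        s⊏l with ⊑-total (c⁻ l) s
        ... | inj₂ s⊏l = s⊏l
        ... | inj₁ l⊑s = ⊥-elim (ns (least⇒HasSucc s (least-resp (≋-intro l⊑s s⊑l) least-c⁻)))
        reading : EventuallyR s (λ e → proj₁ (inLetter (f e)) ≡ true)
        reading = eventuallyR (c⁻ l) s⊏l λ e s⊏e e⊏l → reads-x e (⊑-trans c⊑s (⊏⇒⊑ s⊏e)) e⊏l
        reads-x-false : ∀ {q} → limR J f s q → proj₁ (inLetter q) ≡ false → ⊥
        reads-x-false lim xf with limR-meets lim reading
        ... | e , xt , refl = true≢false (trans (sym xt) xf)
        no-x-false : limR J f s q1 ⊎ limR J f s q3 → ⊥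
        no-x-false (inj₁ lim) = reads-x-false lim refl
        no-x-false (inj₂ lim) = reads-x-false lim refl

      impossible : outLetter (f c) ≡ false → ⊥
      impossible c-bad = true≢false (trans (sym out-l) bad-l)
        where
        out-l : outLetter (f (c⁻ l)) ≡ true
        out-l = reads-y⇒out-true (f (c⁻ l)) (trans (sym (cong proj₂ (letter l))) yl)
        bad-l : outLetter (f (c⁻ l)) ≡ false
        bad-l = continuousInduction Bad bad-resp c (λ _ → c-bad) bad-step bad-extend
                  (c⁻ l) (R⇒⊑c⁻ c rl) ⊑-refl

    good⇒out : ∀ c → Good c → outLetter (f c) ≡ true
    good⇒out c (l , rl , yl , xs) with bool-cases (outLetter (f c))
    ... | inj₁ out1 = out1
    ... | inj₂ out0 = ⊥-elim (OutputOfGood.impossible c l rl yl xs out0)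

    -- Output 1 at c without Good c is impossible: the state would be q2,
    -- and q2 would persist (with φ holding on the way) up to c_max.
    module GoodOfOutput (c : Ĵ) (¬good : ¬ Good c) where
      XBetween : Ĵ → Set
      XBetween e = ∀ k → R c k → L e k → x k ≡ true

      Stuck : Ĵ → Set
      Stuck e = f e ≡ q2 × XBetween e

      x-at : ∀ k → proj₁ (inLetter (f (c⁻ k))) ≡ true → x k ≡ true
      x-at k h = trans (cong proj₁ (letter k)) h

      -- Past c, with φ holding in between, output 1 means state q2: a state
      -- reading y = 1 there would witness Good c.
      stuck-if-out : ∀ e → c ⊑ e → XBetween e → outLetter (f e) ≡ true → Stuck e
      stuck-if-out e c⊑e xb out1 = out-true∧¬reads-y⇒q2 (f e) out1 ¬reads-y , xb
        where
        ¬reads-y : proj₂ (inLetter (f e)) ≡ false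
        ¬reads-y with bool-cases (proj₂ (inLetter (f e)))
        ... | inj₂ yf = yf
        ... | inj₁ yt with y-true-at e yt
        ...   | m , e≋ , ym = ⊥-elim (¬good (m , ⊑-R c⊑e (proj₁ (≋c⁻⇒least e≋)) , ym ,
                                λ k rk k<m → xb k rk (⊑-L (≋⇒⊒ e≋) (<⇒L⁻ k<m))))

      stuck-resp : a ≋ b → Stuck a → Stuck b
      stuck-resp eq (fa≡q2 , xa) = trans (sym (f-resp eq)) fa≡q2 , λ k rk lb → xa k rk (⊑-L (≋⇒⊒ eq) lb)

      -- Successor transitions from q2 and left limits of q2's keep output 1,
      -- hence (by the above) stay in q2.
      stuck-step : ∀ s → c ⊏ s → (∀ e → c ⊑ e → e ⊏ s → Stuck e) → Stuck s
      stuck-step s c⊏s H = stuck-if-out s (⊏⇒⊑ c⊏s) xb out1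
        where
        xb : XBetween s
        xb k rk lk = x-at k (cong (λ q → proj₁ (inLetter q)) (proj₁ (H (c⁻ k) (R⇒⊑c⁻ c rk) (L⇒c⁻⊏ s lk))))
        out1 : outLetter (f s) ≡ true
        out1 with arrival c⊏s
        ... | inj₁ (p , c⊑p , p⊏s , nf) =
          q2-stays-good (f s) (subst (λ q → ¬ Forbidden q (f s)) (proj₁ (H p c⊑p p⊏s)) nf)
        ... | inj₂ (_ , arrive) = leftU-⊆q2 arrive (limL-from c⊏s λ e c⊑e e⊏s → proj₁ (H e c⊑e e⊏s))

      ReadsX∧Out : St → Set
      ReadsX∧Out q = proj₁ (inLetter q) ≡ true × outLetter q ≡ true

      stuck-spreads : ∀ s → c ⊑ s → Stuck s → ¬ HasSucc J s →
                      EventuallyR s (λ e → ReadsX∧Out (f e)) → EventuallyR s Stuck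
      stuck-spreads s c⊑s (_ , xb-s) ns (eventuallyR far s⊏far near) =
        eventuallyR far s⊏far λ e s⊏e e⊏far →
          stuck-if-out e (⊑-trans c⊑s (⊏⇒⊑ s⊏e)) (xb e e⊏far) (proj₂ (near e s⊏e e⊏far))
        where
        xb : ∀ e → e ⊏ far → XBetween e
        xb e e⊏far k rk lk with L-or-R s k
        ... | inj₁ lsk = xb-s k rk lsk
        ... | inj₂ rsk with ¬HasSucc⇒noLeast s ns rsk
        ...   | k′ , rk′ , k′<k =
          x-at k (proj₁ (near (c⁻ k) (R<⇒⊏c⁻ s rk′ k′<k) (⊏-trans (L⇒c⁻⊏ e lk) e⊏far)))

      -- The right limit set of q2 is within {q0, q2}, whose states read x = 1
      -- and output 1.
      stuck-extend : ∀ s → c ⊑ s → (∀ e → c ⊑ e → e ⊑ s → Stuck e) →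
                     ¬ _≈ᶜ_ J s (cmax J) → ¬ HasSucc J s → EventuallyR s Stuck
      stuck-extend s c⊑s H ne ns = stuck-spreads s c⊑s stuck-s ns
        (evR-only ReadsX∧Out ne λ q ¬S lim → ¬S (q0q2-reads-x∧out q (limits q lim)))
        where
        stuck-s : Stuck s
        stuck-s = H s c⊑s ⊑-refl
        limits : ∀ t → limR J f s t → t ≡ q0 ⊎ t ≡ q2
        limits = rightU-q2 (subst (λ q → rightU q (limR J f s)) (proj₁ stuck-s) (limRight r s ne ns))

      -- q2 would persist up to c_max, which is final only for q4.
      impossible : Stuck c → ⊥
      impossible stuck-c = q2≢q4 (trans (sym (proj₁ stuck-max)) (fin r))
        where
        stuck-max : Stuck (cmax J)
        stuck-max = continuousInduction Stuck stuck-resp c stuck-c stuck-step stuck-extend (cmax J) ⊑cmax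
        q2≢q4 : q2 ≡ q4 → ⊥
        q2≢q4 ()

    out⇒good : ∀ c → outLetter (f c) ≡ true → Good c
    out⇒good c out1 = byContradiction λ ¬good → let open GoodOfOutput c ¬good in
      impossible (stuck-if-out c ⊑-refl (λ k rk lk → ⊥-elim (L∧R-⊥ c lk rk)) out1)

    output⇔until : ∀ j → (out r j ≡ true) ⇔ Until J x y j
    output⇔until j = mk⇔ (λ o → Equivalence.from until⇔good (out⇒good (c⁺ j) (trans (sym out≡) o)))
                         (λ u → trans out≡ (good⇒out (c⁺ j) (Equivalence.to until⇔good u)))
      where
      out≡ : out r j ≡ outLetter (f (c⁺ j))
      out≡ = proj₂ (proj₂ (succ r j))

  -- The canonical run: at c_m^- it reads the letter of m, at the other cuts
  -- it sits in q2 or q4; in both cases its output at c is Good c.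
  module CanonicalRun where
    open ≡-Reasoning

    good? : Ĵ → Bool
    good? c = decide (Good c)

    good?-resp : c ≋ d → good? c ≡ good? d
    good?-resp eq = decide-cong (good-resp eq) (good-resp (≋-sym eq))

    least-or-not : ∀ c → (∃ λ m → Least c m) ⊎ ¬ (∃ λ m → Least c m)
    least-or-not c with em {∃ λ m → Least c m}
    ... | yes lc = inj₁ lc
    ... | no ¬lc = inj₂ ¬lc

    stateFrom : (c : Ĵ) → (∃ λ m → Least c m) ⊎ ¬ (∃ λ m → Least c m) → St
    stateFrom c (inj₁ (m , _)) = readState (x m) (y m) (good? c)
    stateFrom c (inj₂ _) = limitState (good? c)

    state : Ĵ → St
    state c = stateFrom c (least-or-not c)

    open Limits state
    open StateLimits state

    state-least : Least c m → state c ≡ readState (x m) (y m) (good? c)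
    state-least {c = c} {m = m} lm with least-or-not c
    ... | inj₁ (m′ , lm′) = cong (λ k → readState (x k) (y k) (good? c)) (least-unique c lm′ lm)
    ... | inj₂ ¬lc = ⊥-elim (¬lc (m , lm))

    state-noLeast : ¬ (∃ λ m → Least c m) → state c ≡ limitState (good? c)
    state-noLeast {c = c} ¬lc with least-or-not c
    ... | inj₁ lc = ⊥-elim (¬lc lc)
    ... | inj₂ _ = refl

    state-resp : c ≋ d → state c ≡ state d
    state-resp {c = c} {d = d} eq with least-or-not c
    ... | inj₁ (m , lm) = begin
      readState (x m) (y m) (good? c) ≡⟨ cong (readState (x m) (y m)) (good?-resp eq) ⟩
      readState (x m) (y m) (good? d) ≡⟨ sym (state-least (least-resp eq lm)) ⟩
      state d                         ∎
    ... | inj₂ ¬lc = begin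
      limitState (good? c) ≡⟨ cong limitState (good?-resp eq) ⟩
      limitState (good? d) ≡⟨ sym (state-noLeast λ (m , lm) → ¬lc (m , least-resp (≋-sym eq) lm)) ⟩
      state d              ∎

    letter-at : ∀ k → inLetter (state (c⁻ k)) ≡ (x k , y k)
    letter-at k = trans (cong inLetter (state-least least-c⁻)) (readState-reads (x k) (y k) _)

    good-if-y : ∀ c → Least c m → y m ≡ true → Good c
    good-if-y {m = m} c (rm , least) ym = m , rm , ym , λ k rk k<m → ⊥-elim (least k rk k<m)

    ¬good-if-00 : ∀ c → Least c m → x m ≡ false → y m ≡ false → ¬ Good c
    ¬good-if-00 {m = m} c (rm , least) xm ym (l , rl , yl , xs) with compare m l
    ... | tri< m<l _ _ = true≢false (trans (sym (xs m rm m<l)) xm)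
    ... | tri≈ _ refl _ = true≢false (trans (sym yl) ym)
    ... | tri> _ _ l<m = least l rl l<m

    state-out : ∀ c → outLetter (state c) ≡ good? c
    state-out c with least-or-not c
    ... | inj₂ _ = limitState-out (good? c)
    ... | inj₁ (m , lm) with x m in xm | y m in ym
    ...   | true | true = sym (decide-true (good-if-y c lm ym))
    ...   | false | true = sym (decide-true (good-if-y c lm ym))
    ...   | true | false = limitState-out (good? c)
    ...   | false | false = sym (decide-false (¬good-if-00 c lm xm ym))

    reads-x0-at : ∀ e → proj₁ (inLetter (state e)) ≡ false → ∃ λ m → Least e m × x m ≡ false
    reads-x0-at e xf with least-or-not e
    ... | inj₁ (m , lm) = m , lm , trans (sym (cong proj₁ (readState-reads (x m) (y m) (good? e)))) xf
    ... | inj₂ _ = ⊥-elim (true≢false (trans (sym (cong proj₁ (limitState-reads (good? e)))) xf))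

    -- Successor transitions: a forbidden pair starts in a state reading
    -- (1,0) and changes the output, but across a position carrying (1,0)
    -- Good does not change.
    good?-across : ∀ j → x j ≡ true → y j ≡ false → good? (c⁻ j) ≡ good? (c⁺ j)
    good?-across j xj yj =
      decide-cong (good-restrict c⁻⊑c⁺ λ k rk lk → subst (λ k → y k ≡ false) (sym (between-c⁻-c⁺ rk lk)) yj)
                  (good-extend c⁻⊑c⁺ λ k rk lk → subst (λ k → x k ≡ true) (sym (between-c⁻-c⁺ rk lk)) xj)
      where
      c⁻⊑c⁺ : c⁻ j ⊑ c⁺ j
      c⁻⊑c⁺ = ⊏⇒⊑ (proj₁ c⁻-covered)

    successor : ∀ j → succU (state (c⁻ j)) (x j , y j) (outLetter (state (c⁺ j))) (state (c⁺ j))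
    successor j = allowed , sym (letter-at j) , refl
      where
      allowed : ¬ Forbidden (state (c⁻ j)) (state (c⁺ j))
      allowed fb = forbidden-out fb (begin
        outLetter (state (c⁻ j)) ≡⟨ state-out (c⁻ j) ⟩
        good? (c⁻ j)             ≡⟨ good?-across j (cong proj₁ reads-10) (cong proj₂ reads-10) ⟩
        good? (c⁺ j)             ≡⟨ sym (state-out (c⁺ j)) ⟩
        outLetter (state (c⁺ j)) ∎)
        where
        reads-10 : (x j , y j) ≡ (true , false)
        reads-10 = trans (sym (letter-at j)) (forbidden-source fb)

    -- c_max has no least position and is not Good, so it carries q4.
    final-state : state (cmax J) ≡ q4
    final-state = begin
      state (cmax J)               ≡⟨ state-noLeast (λ (_ , rm , _) → true≢false rm) ⟩
      limitState (good? (cmax J))  ≡⟨ cong limitState (decide-false λ (_ , rl , _) → true≢false rl) ⟩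
      q4                           ∎

    -- Left limits: unless q0, q1 or q3 recurs, the states just left of c
    -- read (1,0), so Good, hence the state, is constant there.
    leftLimit-reading-10 : ∀ c → ¬ HasPred J c → EventuallyL c (λ e → inLetter (state e) ≡ (true , false)) →
                           leftU (limL J state c) (state c)
    leftLimit-reading-10 c np (eventuallyL b b⊏c near) =
      leftU-limitState (good? c) (limL-is np constant) (state-out c)
      where
      e₀ : Ĵ
      e₀ = proj₁ (¬HasPred⇒dense np b⊏c)
      b⊏e₀ : b ⊏ e₀
      b⊏e₀ = proj₁ (proj₂ (¬HasPred⇒dense np b⊏c))
      e₀⊏c : e₀ ⊏ c
      e₀⊏c = proj₂ (proj₂ (¬HasPred⇒dense np b⊏c))
      reads-10 : ∀ k → R e₀ k → L c k → (x k , y k) ≡ (true , false)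
      reads-10 k rk lk = trans (sym (letter-at k)) (near (c⁻ k) (⊏-⊑-trans b⊏e₀ (R⇒⊑c⁻ e₀ rk)) (L⇒c⁻⊏ c lk))
      same-good : ∀ e → e₀ ⊑ e → e ⊑ c → good? e ≡ good? c
      same-good e e₀⊑e e⊑c =
        decide-cong (good-restrict e⊑c λ k rk lk → cong proj₂ (reads-10 k (⊑-R e₀⊑e rk) lk))
                    (good-extend e⊑c λ k rk lk → cong proj₁ (reads-10 k (⊑-R e₀⊑e rk) lk))
      constant : EventuallyL c (λ e → state e ≡ limitState (good? c))
      constant = eventuallyL e₀ e₀⊏c λ e e₀⊏e e⊏c → begin
        state e                          ≡⟨ reads-10⇒limitState (state e) (near e (⊏-trans b⊏e₀ e₀⊏e) e⊏c) ⟩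
        limitState (outLetter (state e)) ≡⟨ cong limitState (state-out e) ⟩
        limitState (good? e)             ≡⟨ cong limitState (same-good e (⊏⇒⊑ e₀⊏e) (⊏⇒⊑ e⊏c)) ⟩
        limitState (good? c)             ∎

    leftLimit : ∀ c → ¬ _≈ᶜ_ J c (cmin J) → ¬ HasPred J c → leftU (limL J state c) (state c)
    leftLimit c ne np with em {limL J state c q0 ⊎ limL J state c q1 ⊎ limL J state c q3}
    ... | yes lim013 = inj₁ lim013
    ... | no ¬lim013 = leftLimit-reading-10 c np
                         (evL-only (λ q → inLetter q ≡ (true , false)) ne (avoid013 ¬lim013))

    -- Right limits at a Good cut c: up to the witness l the states output 1
    -- and read x = 1, so they are q0 or q2.
    rightLimit-good : ∀ c → ¬ _≈ᶜ_ J c (cmax J) → ¬ HasSucc J c → Good c → rightU q2 (limR J state c)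
    rightLimit-good c ne ns (l , rl , yl , xs) = rightU-q2-of em em inhabited ⊆q02
      where
      c⊏l : c ⊏ c⁻ l
      c⊏l = let (k , rk , k<l) = ¬HasSucc⇒noLeast c ns rl in R<⇒⊏c⁻ c rk k<l
      reads-x : ∀ e → c ⊏ e → e ⊏ c⁻ l → proj₁ (inLetter (state e)) ≡ true
      reads-x e c⊏e e⊏l = [ (λ xt → xt) , (λ xf → ⊥-elim (no-x0 xf)) ]′ (bool-cases (proj₁ (inLetter (state e))))
        where
        no-x0 : proj₁ (inLetter (state e)) ≡ false → ⊥
        no-x0 xf = let (m , lm , xm) = reads-x0-at e xf in
          true≢false (trans (sym (xs m (⊑-R (⊏⇒⊑ c⊏e) (proj₁ lm)) (L⁻⇒< (≋c⁻⊏⇒L (least⇒≋c⁻ e lm) e⊏l)))) xm)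
      good : ∀ e → c ⊏ e → e ⊏ c⁻ l → Good e
      good e c⊏e e⊏l = l , ⊑-R (⊏⇒⊑ e⊏l) (proj₁ least-c⁻) , yl , λ k rk → xs k (⊑-R (⊏⇒⊑ c⊏e) rk)
      q0q2 : ∀ e → c ⊏ e → e ⊏ c⁻ l → state e ≡ q0 ⊎ state e ≡ q2
      q0q2 e c⊏e e⊏l = out1∧reads-x⇒q0q2 (state e) (trans (state-out e) (decide-true (good e c⊏e e⊏l)))
                         (reads-x e c⊏e e⊏l)
      ⊆q02 : ∀ t → limR J state c t → t ≡ q0 ⊎ t ≡ q2
      ⊆q02 t lim = let (e , in-q02 , e≡t) = limR-meets lim (eventuallyR (c⁻ l) c⊏l q0q2) in
                   subst (λ q → q ≡ q0 ⊎ q ≡ q2) e≡t in-q02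
      inhabited : limR J state c q0 ⊎ limR J state c q2
      inhabited = let (t , lim) = limR-inhabited {c = c} ns ne in
        [ (λ t≡q0 → inj₁ (subst (limR J state c) t≡q0 lim)) , (λ t≡q2 → inj₂ (subst (limR J state c) t≡q2 lim)) ]′
          (⊆q02 t lim)

    -- Right limits at a cut c that is not Good: unless q1 or q3 recurs, φ
    -- holds just right of c, so no cut there is Good and the state is q4.
    rightLimit-reading-x : ∀ c → ¬ HasSucc J c → ¬ Good c →
                           EventuallyR c (λ e → proj₁ (inLetter (state e)) ≡ true) →
                           limR J state c ≐ (λ t → t ≡ q4)
    rightLimit-reading-x c ns ¬good (eventuallyR b c⊏b near) = limR-is ns (eventuallyR b c⊏b all-q4)
      where
      x-between : ∀ e → e ⊏ b → ∀ k → R c k → L e k → x k ≡ true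
      x-between e e⊏b k rk lk = let (k′ , rk′ , k′<k) = ¬HasSucc⇒noLeast c ns rk in
        trans (sym (cong proj₁ (letter-at k))) (near (c⁻ k) (R<⇒⊏c⁻ c rk′ k′<k) (⊏-trans (L⇒c⁻⊏ e lk) e⊏b))
      all-q4 : ∀ e → c ⊏ e → e ⊏ b → state e ≡ q4
      all-q4 e c⊏e e⊏b = out-false∧reads-x⇒q4 (state e) out0 (near e c⊏e e⊏b)
        where
        out0 : outLetter (state e) ≡ false
        out0 = trans (state-out e) (decide-false λ good-e →
                 ¬good (good-extend (⊏⇒⊑ c⊏e) (x-between e e⊏b) good-e))

    rightLimit-bad : ∀ c → ¬ _≈ᶜ_ J c (cmax J) → ¬ HasSucc J c → ¬ Good c → rightU q4 (limR J state c)
    rightLimit-bad c ne ns ¬good with em {limR J state c q1 ⊎ limR J state c q3}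
    ... | yes lim13 = inj₂ (inj₁ (refl , lim13))
    ... | no ¬lim13 = inj₂ (inj₂ (refl , rightLimit-reading-x c ns ¬good
                        (evR-only (λ q → proj₁ (inLetter q) ≡ true) ne (avoid13 ¬lim13))))

    rightLimit : ∀ c → ¬ _≈ᶜ_ J c (cmax J) → ¬ HasSucc J c → rightU (state c) (limR J state c)
    rightLimit c ne ns =
      subst (λ q → rightU q (limR J state c)) (sym (state-noLeast no-least)) (by-good (bool-cases (good? c)))
      where
      no-least : ¬ (∃ λ m → Least c m)
      no-least (m , lm) = ns (least⇒HasSucc c lm)
      by-good : good? c ≡ true ⊎ good? c ≡ false → rightU (limitState (good? c)) (limR J state c)
      by-good (inj₁ g) rewrite g = rightLimit-good c ne ns (decide-sound g)
      by-good (inj₂ g) rewrite g = rightLimit-bad c ne ns (decide-refute g)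

    run : AcceptingRun AU J (λ j → x j , y j)
    run = record
      { ρ = state ; out = λ j → outLetter (state (c⁺ j))
      ; resp = λ c d c≈d → state-resp (≈ᶜ⇒≋ c≈d)
      ; init = tt ; fin = final-state ; succ = successor
      ; limLeft = leftLimit ; limRight = rightLimit }

mainTheorem3 : ExcludedMiddle 0ℓ → (J : LinearOrder) →
    (x y : LinearOrder.Carrier J → Bool) →
    AcceptingRun AU J (λ j → x j , y j)
    × (∀ (r : AcceptingRun AU J (λ j → x j , y j)) → ∀ j →
         (out r j ≡ true) ⇔ Until J x y j)
mainTheorem3 em J x y = CanonicalRun.run , λ r → Correctness.output⇔until r
  where open UntilOnCuts em J x y
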